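{- For all integers $m>n\ge 3$, the complete bipartite graph $K_{m,n}$ is $P_5$-constrained and not equistarable.
   Context: A graph is $P_5$-constrained if the middle vertex of every (not necessarily induced) path on $5$ vertices has degree at least $3$. For a vertex $v$, $E(v)$ denotes the set of edges incident with $v$ (the star rooted at $v$); such a star is maximal if not properly contained in another star $E(u)$. A graph $G=(V,E)$ without isolated vertices is equistarable if there is $\varphi:E\to\mathbb{R}_+$ such that for all $F\subseteq E$, $F$ is a maximal star iff $\sum_{e\in F}\varphi(e)=1$.
   Formalization: In the definition of equistarable, the edge weights $\varphi$ take values in the nonnegative rationals instead of $\mathbb{R}_+$. -}

module Defs where

open import Data.Bool using (Bool; true; false; if_then_else_; _∧_; _∨_; _xor_; not)
open import Data.Nat using (ℕ; _+_; _<_; _≤_; _<ᵇ_)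
open import Data.Fin using (Fin; toℕ; inject₁; suc)
open import Data.Nat.ListAction using (sum)
open import Data.List using (List; []; _∷_; map; foldr; concatMap; allFin)
open import Data.Product using (Σ; ∃; _×_; _,_)
open import Data.Sum using (_⊎_)
open import Data.Rational using (ℚ; 0ℚ; 1ℚ) renaming (_+_ to _+ℚ_; _≤_ to _≤ℚ_)
open import Function.Bundles using (_⇔_)
open import Function.Definitions using (Injective)
open import Relation.Nullary using (¬_)
open import Relation.Binary.PropositionalEquality using (_≡_; refl)

record Graph : Set where
  field
    N      : ℕ
    Adj    : Fin N → Fin N → Bool
    sym    : ∀ u v → Adj u v ≡ Adj v u
    irrefl : ∀ v → Adj v v ≡ false

module _ (G : Graph) where
  open Graph G

  deg : Fin N → ℕ
  deg v = sum (map (λ u → if Adj v u then 1 else 0) (allFin N))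

  -- P5-constrained: the middle vertex of every (not necessarily induced)
  -- path on 5 vertices has degree at least 3.
  P5Constrained : Set
  P5Constrained =
    (p : Fin 5 → Fin N) → Injective _≡_ _≡_ p →
    (∀ (k : Fin 4) → Adj (p (inject₁ k)) (p (suc k)) ≡ true) →
    3 ≤ deg (p (suc (suc Fin.zero)))
    where import Data.Fin as Fin

  NoIsolated : Set
  NoIsolated = ∀ v → ∃ λ u → Adj v u ≡ true

  -- each edge {i,j} is represented once, by the pair (i , j) with toℕ i < toℕ j
  IsEdge : Fin N → Fin N → Set
  IsEdge i j = (toℕ i < toℕ j) × (Adj i j ≡ true)

  edgeList : List (Fin N × Fin N)
  edgeList = concatMap (λ i → concatMap (λ j →
      if (toℕ i <ᵇ toℕ j) ∧ Adj i j then (i , j) ∷ [] else []) (allFin N)) (allFin N)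

  InStar : Fin N → Fin N → Fin N → Set
  InStar v i j = (i ≡ v) ⊎ (j ≡ v)

  StarSub : Fin N → Fin N → Set
  StarSub u v = ∀ i j → IsEdge i j → InStar u i j → InStar v i j

  ProperStarSub : Fin N → Fin N → Set
  ProperStarSub u v = StarSub u v ×
    (∃ λ i → ∃ λ j → IsEdge i j × InStar v i j × ¬ InStar u i j)

  MaximalStar : Fin N → Set
  MaximalStar v = ∀ u → ¬ ProperStarSub v u

  -- a set of edges F ⊆ E is given by its characteristic function on edges
  EdgeSet : Set
  EdgeSet = Fin N → Fin N → Bool

  IsStarOf : EdgeSet → Fin N → Set
  IsStarOf F v = ∀ i j → IsEdge i j → (F i j ≡ true) ⇔ InStar v i j

  IsMaximalStar : EdgeSet → Set
  IsMaximalStar F = ∃ λ v → MaximalStar v × IsStarOf F v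

  weight : (Fin N → Fin N → ℚ) → EdgeSet → ℚ
  weight φ F = foldr (λ e acc → f e acc) 0ℚ edgeList
    where
    f : Fin N × Fin N → ℚ → ℚ
    f (i , j) acc = if F i j then φ i j +ℚ acc else acc

  Equistarable : Set
  Equistarable = NoIsolated ×
    (Σ (Fin N → Fin N → ℚ) λ φ →
       (∀ i j → IsEdge i j → 0ℚ ≤ℚ φ i j) ×
       (∀ (F : EdgeSet) → IsMaximalStar F ⇔ (weight φ F ≡ 1ℚ)))

-- complete bipartite graph K_{m,n}: vertices Fin (m + n); vertices with
-- toℕ < m form one side, the rest the other side.
side : (m : ℕ) {N : ℕ} → Fin N → Bool
side m i = toℕ i <ᵇ m

xor-comm : ∀ a b → (a xor b) ≡ (b xor a)
xor-comm true true = refl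
xor-comm true false = refl
xor-comm false true = refl
xor-comm false false = refl

xor-self : ∀ a → (a xor a) ≡ false
xor-self true = refl
xor-self false = refl

K : ℕ → ℕ → Graph
K m n = record
  { N = m + n
  ; Adj = λ i j → side m i xor side m j
  ; sym = λ i j → xor-comm (side m i) (side m j)
  ; irrefl = λ i → xor-self (side m i)
  }

{-# OPTIONS --safe #-}
module Submission where

-- Every vertex of K_{m,n} has degree m or n.  A vertex with two distinct neighbours spans a
-- maximal star, since a star containing it must be centred on both neighbours; so for m, n ≥ 2
-- an equistarable weighting gives every star weight 1.  Each edge lies in exactly one star
-- centred on the left side and in exactly one centred on the right side, hence summing the
-- star weights over either side gives the total weight: m = total = n.

open import Defs
open import Data.Nat using (_≤_; _<_)
open import Data.Product using (_×_)
open import Relation.Nullary using (¬_)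

open import Algebra.Properties.Group using (∙-cancelˡ)
open import Data.Bool using (Bool; true; false; if_then_else_; _∧_; _∨_; _xor_)
open import Data.Bool.Properties using (T-≡; ∨-zeroʳ)
open import Data.Fin using (Fin; zero; suc; toℕ; _↑ˡ_; _↑ʳ_; splitAt; _≟_)
open import Data.Fin.Properties
  using ( toℕ<n; toℕ-↑ˡ; toℕ-↑ʳ; toℕ-injective; ↑ˡ-injective; ↑ʳ-injective
        ; splitAt⁻¹-↑ˡ; splitAt⁻¹-↑ʳ; 0≢1+n; suc-injective)
open import Data.List using (List; []; _∷_; foldr; tabulate)
open import Data.List.Properties using (map-tabulate; tabulate-cong)
open import Data.List.Relation.Unary.All as All using (All; []; _∷_)
open import Data.List.Relation.Unary.All.Properties using (concat⁺; map⁺; tabulate⁺)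
open import Data.Nat using (ℕ; zero; suc; _+_; _*_; _<ᵇ_; s≤s)
open import Relation.Binary.Definitions using (tri<; tri≈; tri>)
import Data.Nat.Properties as ℕ
open import Data.Nat.ListAction using (sum)
open import Data.Product using (∃; ∃₂; ∃!; _,_; uncurry)
open import Data.Rational using (ℚ; 0ℚ; 1ℚ) renaming (_+_ to _+ℚ_; _≤_ to _≤ℚ_; _<_ to _<ℚ_)
import Data.Rational.Properties as ℚ
open import Algebra.Properties.CommutativeMonoid.Sum ℚ.+-0-commutativeMonoid
  using (sum-syntax; sum-cong-≗; sum-replicate-zero; ∑-distrib-+)
open import Data.Sum using (_⊎_; inj₁; inj₂; [_,_]′; swap)
open import Function using (id; _∘_; _⇔_; Equivalence; mk⇔)
open import Relation.Nullary using (yes; no; does; contradiction)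
open import Relation.Nullary.Decidable using (dec-true)
open import Relation.Binary.PropositionalEquality
  using (_≡_; _≢_; refl; sym; trans; cong; cong₂; subst)
open import Relation.Binary.PropositionalEquality.Properties using (module ≡-Reasoning)

if-≢true : ∀ {A : Set} {b : Bool} {x y : A} → b ≢ true → (if b then x else y) ≡ y
if-≢true {b = false} _ = refl
if-≢true {b = true} b≢true = contradiction refl b≢true

sum-tabulate-↑ : ∀ m {n} (f : Fin (m + n) → ℕ) →
  sum (tabulate f) ≡ sum (tabulate (f ∘ (_↑ˡ n))) + sum (tabulate (f ∘ (m ↑ʳ_)))
sum-tabulate-↑ zero f = refl
sum-tabulate-↑ (suc m) f =
  trans (cong (f zero +_) (sum-tabulate-↑ m (f ∘ suc))) (sym (ℕ.+-assoc (f zero) _ _))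

sum-tabulate-const : ∀ k c → sum (tabulate {n = k} (λ _ → c)) ≡ k * c
sum-tabulate-const zero c = refl
sum-tabulate-const (suc k) c = cong (c +_) (sum-tabulate-const k c)

∑-indicator-∃! : ∀ {c} (b : Fin c → Bool) x → ∃! _≡_ (λ k → b k ≡ true) →
  ∑[ k < c ] (if b k then x else 0ℚ) ≡ x
∑-indicator-∃! {suc c} b x (zero , b₀ , unique) = begin
  (if b zero then x else 0ℚ) +ℚ ∑[ k < c ] (if b (suc k) then x else 0ℚ)
    ≡⟨ cong₂ _+ℚ_ (cong (λ b₀ → if b₀ then x else 0ℚ) b₀) (sum-cong-≗ off) ⟩
  x +ℚ ∑[ k < c ] 0ℚ                       ≡⟨ cong (x +ℚ_) (sum-replicate-zero c) ⟩
  x +ℚ 0ℚ                                  ≡⟨ ℚ.+-identityʳ x ⟩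
  x                                        ∎
  where
  open ≡-Reasoning
  off : ∀ k → (if b (suc k) then x else 0ℚ) ≡ 0ℚ
  off k = if-≢true (λ bk → 0≢1+n (unique bk))
∑-indicator-∃! {suc c} b x (suc k , bk , unique) = begin
  (if b zero then x else 0ℚ) +ℚ ∑[ i < c ] (if b (suc i) then x else 0ℚ)
    ≡⟨ cong₂ _+ℚ_ (if-≢true (λ b₀ → 0≢1+n (sym (unique b₀))))
                  (∑-indicator-∃! (b ∘ suc) x (k , bk , λ bj → suc-injective (unique bj))) ⟩
  0ℚ +ℚ x                                  ≡⟨ ℚ.+-identityˡ x ⟩
  x                                        ∎
  where open ≡-Reasoning

0≤∑1 : ∀ c → 0ℚ ≤ℚ ∑[ k < c ] 1ℚ
0≤∑1 zero = ℚ.≤-refl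
0≤∑1 (suc c) = ℚ.+-mono-≤ (ℚ.nonNegative⁻¹ 1ℚ) (0≤∑1 c)

0<∑1 : ∀ c → 0ℚ <ℚ ∑[ k < suc c ] 1ℚ
0<∑1 c = ℚ.+-mono-<-≤ (ℚ.positive⁻¹ 1ℚ) (0≤∑1 c)

∑1-injective : ∀ {a b} → ∑[ k < a ] 1ℚ ≡ ∑[ k < b ] 1ℚ → a ≡ b
∑1-injective {zero} {zero} _ = refl
∑1-injective {zero} {suc b} eq = contradiction eq (ℚ.<⇒≢ (0<∑1 b))
∑1-injective {suc a} {zero} eq = contradiction (sym eq) (ℚ.<⇒≢ (0<∑1 a))
∑1-injective {suc a} {suc b} eq = cong suc (∑1-injective (∙-cancelˡ ℚ.+-0-group 1ℚ _ _ eq))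

two-distinct : ∀ {k} → 2 ≤ k → ∃₂ λ (x y : Fin k) → x ≢ y
two-distinct (s≤s (s≤s _)) = zero , suc zero , 0≢1+n

module _ (G : Graph) where
  open Graph G using (N; Adj; irrefl) renaming (sym to Adj-sym)

  adjacent⇒IsEdge : ∀ {v w} → Adj v w ≡ true → IsEdge G v w ⊎ IsEdge G w v
  adjacent⇒IsEdge {v} {w} vw with ℕ.<-cmp (toℕ v) (toℕ w)
  ... | tri< v<w _ _ = inj₁ (v<w , vw)
  ... | tri≈ _ v≡w _ with refl ← toℕ-injective v≡w = contradiction (trans (sym vw) (irrefl v)) λ ()
  ... | tri> _ _ w<v = inj₂ (w<v , trans (Adj-sym w v) vw)

  StarSub⇒centre-on-edge : ∀ {v u w} → StarSub G v u → Adj v w ≡ true → v ≡ u ⊎ w ≡ u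
  StarSub⇒centre-on-edge E[v]⊆E[u] vw with adjacent⇒IsEdge vw
  ... | inj₁ e = E[v]⊆E[u] _ _ e (inj₁ refl)
  ... | inj₂ e = swap (E[v]⊆E[u] _ _ e (inj₂ refl))

  two-neighbours⇒MaximalStar : ∀ {v w₁ w₂} → Adj v w₁ ≡ true → Adj v w₂ ≡ true → w₁ ≢ w₂ →
    MaximalStar G v
  two-neighbours⇒MaximalStar vw₁ vw₂ w₁≢w₂ u (E[v]⊆E[u] , _ , _ , _ , u∈ij , v∉ij)
    with StarSub⇒centre-on-edge E[v]⊆E[u] vw₁ | StarSub⇒centre-on-edge E[v]⊆E[u] vw₂
  ... | inj₁ refl | _ = v∉ij u∈ij
  ... | _ | inj₁ refl = v∉ij u∈ij
  ... | inj₂ w₁≡u | inj₂ w₂≡u = w₁≢w₂ (trans w₁≡u (sym w₂≡u))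

  star : Fin N → EdgeSet G
  star v i j = does (i ≟ v) ∨ does (j ≟ v)

  star⇔InStar : ∀ v i j → star v i j ≡ true ⇔ InStar G v i j
  star⇔InStar v i j = mk⇔ to from
    where
    to : star v i j ≡ true → InStar G v i j
    to s with i ≟ v | j ≟ v
    ... | yes i≡v | _ = inj₁ i≡v
    ... | no _ | yes j≡v = inj₂ j≡v
    to () | no _ | no _
    from : InStar G v i j → star v i j ≡ true
    from (inj₁ i≡v) rewrite dec-true (i ≟ v) i≡v = refl
    from (inj₂ j≡v) rewrite dec-true (j ≟ v) j≡v = ∨-zeroʳ _

  edgeList-IsEdge : All (uncurry (IsEdge G)) (edgeList G)
  edgeList-IsEdge = concat⁺ (map⁺ (tabulate⁺ λ i → concat⁺ (map⁺ (tabulate⁺ (candidate i)))))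
    where
    candidate : ∀ i j →
      All (uncurry (IsEdge G)) (if (toℕ i <ᵇ toℕ j) ∧ Adj i j then (i , j) ∷ [] else [])
    candidate i j with toℕ i <ᵇ toℕ j in i<ᵇj | Adj i j in ij
    ... | true | true = (ℕ.<ᵇ⇒< _ _ (Equivalence.from T-≡ i<ᵇj) , ij) ∷ []
    ... | true | false = []
    ... | false | _ = []

  -- weight G φ F is definitionally weightOn φ F (edgeList G).
  weightOn : (Fin N → Fin N → ℚ) → EdgeSet G → List (Fin N × Fin N) → ℚ
  weightOn φ F = foldr step 0ℚ
    where
    step : Fin N × Fin N → ℚ → ℚ
    step (i , j) acc = if F i j then φ i j +ℚ acc else acc

  weightOn-∷ : ∀ φ F i j L →
    weightOn φ F ((i , j) ∷ L) ≡ (if F i j then φ i j else 0ℚ) +ℚ weightOn φ F L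
  weightOn-∷ φ F i j L with F i j
  ... | true = refl
  ... | false = sym (ℚ.+-identityˡ _)

  ∑-weightOn-partition : ∀ {c} φ (F : Fin c → EdgeSet G) L →
    All (uncurry λ i j → ∃! _≡_ λ k → F k i j ≡ true) L →
    ∑[ k < c ] weightOn φ (F k) L ≡ weightOn φ (λ _ _ → true) L
  ∑-weightOn-partition {c} φ F [] [] = sum-replicate-zero c
  ∑-weightOn-partition {c} φ F ((i , j) ∷ L) (once ∷ rest) = begin
    ∑[ k < c ] weightOn φ (F k) ((i , j) ∷ L)
      ≡⟨ sum-cong-≗ (λ k → weightOn-∷ φ (F k) i j L) ⟩
    ∑[ k < c ] ((if F k i j then φ i j else 0ℚ) +ℚ weightOn φ (F k) L)
      ≡⟨ ∑-distrib-+ (λ k → if F k i j then φ i j else 0ℚ) (λ k → weightOn φ (F k) L) ⟩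
    ∑[ k < c ] (if F k i j then φ i j else 0ℚ) +ℚ ∑[ k < c ] weightOn φ (F k) L
      ≡⟨ cong₂ _+ℚ_ (∑-indicator-∃! (λ k → F k i j) (φ i j) once) (∑-weightOn-partition φ F L rest) ⟩
    φ i j +ℚ weightOn φ (λ _ _ → true) L ∎
    where open ≡-Reasoning

  ∑1≡total-weight : ∀ {c} φ → (∀ F → IsMaximalStar G F ⇔ (weight G φ F ≡ 1ℚ)) →
    (centre : Fin c → Fin N) → (∀ k → MaximalStar G (centre k)) →
    (∀ {i j} → IsEdge G i j → ∃! _≡_ λ k → star (centre k) i j ≡ true) →
    ∑[ k < c ] 1ℚ ≡ weight G φ (λ _ _ → true)
  ∑1≡total-weight {c} φ maximal⇔weight≡1 centre maximal once = begin
    ∑[ k < c ] 1ℚ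
      ≡⟨ sum-cong-≗ (λ k → Equivalence.to (maximal⇔weight≡1 _) (star-is-maximal k)) ⟨
    ∑[ k < c ] weight G φ (star (centre k))
      ≡⟨ ∑-weightOn-partition φ (star ∘ centre) (edgeList G) (All.map once edgeList-IsEdge) ⟩
    weight G φ (λ _ _ → true) ∎
    where
    open ≡-Reasoning
    star-is-maximal : ∀ k → IsMaximalStar G (star (centre k))
    star-is-maximal k = centre k , maximal k , λ i j _ → star⇔InStar (centre k) i j

module _ {m n : ℕ} where

  side-↑ˡ : ∀ (a : Fin m) → side m (a ↑ˡ n) ≡ true
  side-↑ˡ a = Equivalence.to T-≡ (ℕ.<⇒<ᵇ (subst (_< m) (sym (toℕ-↑ˡ a n)) (toℕ<n a)))

  side-↑ʳ : ∀ (b : Fin n) → side m (m ↑ʳ b) ≡ false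
  side-↑ʳ b rewrite toℕ-↑ʳ m b = m+k≮ᵇm m (toℕ b)
    where
    m+k≮ᵇm : ∀ m k → (m + k <ᵇ m) ≡ false
    m+k≮ᵇm zero k = refl
    m+k≮ᵇm (suc m) k = m+k≮ᵇm m k

  ↑ˡ-or-↑ʳ : ∀ (v : Fin (m + n)) → (∃ λ a → v ≡ a ↑ˡ n) ⊎ (∃ λ b → v ≡ m ↑ʳ b)
  ↑ˡ-or-↑ʳ v with splitAt m v in eq
  ... | inj₁ a = inj₁ (a , sym (splitAt⁻¹-↑ˡ eq))
  ... | inj₂ b = inj₂ (b , sym (splitAt⁻¹-↑ʳ eq))

  toℕ-↑ˡ<toℕ-↑ʳ : ∀ (a : Fin m) (b : Fin n) → toℕ (a ↑ˡ n) < toℕ (m ↑ʳ b)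
  toℕ-↑ˡ<toℕ-↑ʳ a b = begin-strict
    toℕ (a ↑ˡ n)  ≡⟨ toℕ-↑ˡ a n ⟩
    toℕ a         <⟨ toℕ<n a ⟩
    m             ≤⟨ ℕ.m≤m+n m (toℕ b) ⟩
    m + toℕ b     ≡⟨ toℕ-↑ʳ m b ⟨
    toℕ (m ↑ʳ b)  ∎
    where open ℕ.≤-Reasoning

  ↑ˡ≢↑ʳ : ∀ (a : Fin m) (b : Fin n) → a ↑ˡ n ≢ m ↑ʳ b
  ↑ˡ≢↑ʳ a b eq = ℕ.<⇒≢ (toℕ-↑ˡ<toℕ-↑ʳ a b) (cong toℕ eq)

  Adj-↑ˡ-↑ʳ : ∀ (a : Fin m) (b : Fin n) → Graph.Adj (K m n) (a ↑ˡ n) (m ↑ʳ b) ≡ true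
  Adj-↑ˡ-↑ʳ a b = cong₂ _xor_ (side-↑ˡ a) (side-↑ʳ b)

  Adj-↑ʳ-↑ˡ : ∀ (b : Fin n) (a : Fin m) → Graph.Adj (K m n) (m ↑ʳ b) (a ↑ˡ n) ≡ true
  Adj-↑ʳ-↑ˡ b a = trans (Graph.sym (K m n) _ _) (Adj-↑ˡ-↑ʳ a b)

  IsEdge⇒↑ˡ-↑ʳ : ∀ {i j} → IsEdge (K m n) i j → ∃₂ λ a b → i ≡ a ↑ˡ n × j ≡ m ↑ʳ b
  IsEdge⇒↑ˡ-↑ʳ {i} {j} (i<j , ij) with ↑ˡ-or-↑ʳ i | ↑ˡ-or-↑ʳ j
  ... | inj₁ (a , refl) | inj₂ (b , refl) = a , b , refl , refl
  ... | inj₁ (a₁ , refl) | inj₁ (a₂ , refl) =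
    contradiction (trans (sym ij) (cong₂ _xor_ (side-↑ˡ a₁) (side-↑ˡ a₂))) λ ()
  ... | inj₂ (b₁ , refl) | inj₂ (b₂ , refl) =
    contradiction (trans (sym ij) (cong₂ _xor_ (side-↑ʳ b₁) (side-↑ʳ b₂))) λ ()
  ... | inj₂ (b , refl) | inj₁ (a , refl) = contradiction i<j (ℕ.<-asym (toℕ-↑ˡ<toℕ-↑ʳ a b))

  deg-K : ∀ v → deg (K m n) v ≡ (if side m v then n else m)
  deg-K v = begin
    deg (K m n) v
      ≡⟨ cong sum (map-tabulate id adjacency) ⟩
    sum (tabulate adjacency)
      ≡⟨ sum-tabulate-↑ m adjacency ⟩
    sum (tabulate (adjacency ∘ (_↑ˡ n))) + sum (tabulate (adjacency ∘ (m ↑ʳ_)))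
      ≡⟨ cong₂ _+_ (cong sum (tabulate-cong λ a → cong (λ s → count (side m v xor s)) (side-↑ˡ a)))
                   (cong sum (tabulate-cong λ b → cong (λ s → count (side m v xor s)) (side-↑ʳ b))) ⟩
    sum (tabulate {n = m} λ _ → count (side m v xor true))
      + sum (tabulate {n = n} λ _ → count (side m v xor false))
      ≡⟨ cong₂ _+_ (sum-tabulate-const m _) (sum-tabulate-const n _) ⟩
    m * count (side m v xor true) + n * count (side m v xor false)
      ≡⟨ by-side (side m v) ⟩
    (if side m v then n else m) ∎
    where
    open ≡-Reasoning
    count : Bool → ℕ
    count b = if b then 1 else 0
    adjacency : Fin (m + n) → ℕ
    adjacency u = count (Graph.Adj (K m n) v u)
    by-side : ∀ s → m * count (s xor true) + n * count (s xor false) ≡ (if s then n else m)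
    by-side true = cong₂ _+_ (ℕ.*-zeroʳ m) (ℕ.*-identityʳ n)
    by-side false = trans (cong₂ _+_ (ℕ.*-identityʳ m) (ℕ.*-zeroʳ n)) (ℕ.+-identityʳ m)

  K-deg-≥ : ∀ {k} → k ≤ m → k ≤ n → ∀ v → k ≤ deg (K m n) v
  K-deg-≥ {k} k≤m k≤n v = subst (k ≤_) (sym (deg-K v)) (by-side (side m v))
    where
    by-side : ∀ s → k ≤ (if s then n else m)
    by-side true = k≤n
    by-side false = k≤m

  K-MaximalStar : 2 ≤ m → 2 ≤ n → ∀ v → MaximalStar (K m n) v
  K-MaximalStar 2≤m 2≤n v with ↑ˡ-or-↑ʳ v | two-distinct 2≤m | two-distinct 2≤n
  ... | inj₁ (a , refl) | _ | b₁ , b₂ , b₁≢b₂ =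
    two-neighbours⇒MaximalStar (K m n) (Adj-↑ˡ-↑ʳ a b₁) (Adj-↑ˡ-↑ʳ a b₂) (b₁≢b₂ ∘ ↑ʳ-injective m b₁ b₂)
  ... | inj₂ (b , refl) | a₁ , a₂ , a₁≢a₂ | _ =
    two-neighbours⇒MaximalStar (K m n) (Adj-↑ʳ-↑ˡ b a₁) (Adj-↑ʳ-↑ˡ b a₂) (a₁≢a₂ ∘ ↑ˡ-injective n a₁ a₂)

  IsEdge⇒∃!-↑ˡ-star : ∀ {i j} → IsEdge (K m n) i j →
    ∃! _≡_ λ a → star (K m n) (a ↑ˡ n) i j ≡ true
  IsEdge⇒∃!-↑ˡ-star e with IsEdge⇒↑ˡ-↑ʳ e
  ... | a , b , refl , refl =
    a , Equivalence.from (star⇔InStar (K m n) (a ↑ˡ n) (a ↑ˡ n) (m ↑ʳ b)) (inj₁ refl) , λ s →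
    [ ↑ˡ-injective n a _ , (λ eq → contradiction (sym eq) (↑ˡ≢↑ʳ _ b)) ]′
      (Equivalence.to (star⇔InStar (K m n) _ _ _) s)

  IsEdge⇒∃!-↑ʳ-star : ∀ {i j} → IsEdge (K m n) i j →
    ∃! _≡_ λ b → star (K m n) (m ↑ʳ b) i j ≡ true
  IsEdge⇒∃!-↑ʳ-star e with IsEdge⇒↑ˡ-↑ʳ e
  ... | a , b , refl , refl =
    b , Equivalence.from (star⇔InStar (K m n) (m ↑ʳ b) (a ↑ˡ n) (m ↑ʳ b)) (inj₂ refl) , λ s →
    [ (λ eq → contradiction eq (↑ˡ≢↑ʳ a _)) , ↑ʳ-injective m b _ ]′
      (Equivalence.to (star⇔InStar (K m n) _ _ _) s)

  K-not-Equistarable : 2 ≤ m → 2 ≤ n → m ≢ n → ¬ Equistarable (K m n)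
  K-not-Equistarable 2≤m 2≤n m≢n (_ , φ , _ , maximal⇔weight≡1) = m≢n (∑1-injective (begin
    ∑[ a < m ] 1ℚ                    ≡⟨ stars-total (_↑ˡ n) IsEdge⇒∃!-↑ˡ-star ⟩
    weight (K m n) φ (λ _ _ → true)  ≡⟨ stars-total (m ↑ʳ_) IsEdge⇒∃!-↑ʳ-star ⟨
    ∑[ b < n ] 1ℚ                    ∎))
    where
    open ≡-Reasoning
    stars-total : ∀ {c} (centre : Fin c → Fin (m + n)) →
      (∀ {i j} → IsEdge (K m n) i j → ∃! _≡_ λ k → star (K m n) (centre k) i j ≡ true) →
      ∑[ k < c ] 1ℚ ≡ weight (K m n) φ (λ _ _ → true)
    stars-total centre =
      ∑1≡total-weight (K m n) φ maximal⇔weight≡1 centre (K-MaximalStar 2≤m 2≤n ∘ centre)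

proposition1 : ∀ m n → 3 ≤ n → n < m → P5Constrained (K m n) × ¬ Equistarable (K m n)
proposition1 m n 3≤n n<m =
    (λ p _ _ → K-deg-≥ 3≤m 3≤n (p _))
  , K-not-Equistarable (ℕ.≤-trans 2≤3 3≤m) (ℕ.≤-trans 2≤3 3≤n) (ℕ.>⇒≢ n<m)
  where
  2≤3 : 2 ≤ 3
  2≤3 = ℕ.n≤1+n 2
  3≤m : 3 ≤ m
  3≤m = ℕ.≤-trans 3≤n (ℕ.<⇒≤ n<m)
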